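{- Let $D$ be any strongly connected digraph and let $f$ be any vertex-direction of $D$. Then exactly one of the following holds: (i) $f$ is dominated; (ii) there is a strictly descending sequence $((A_i,B_i))_{i\in\mathbb{N}}$ of finite order separations of $D$ with pairwise disjoint separators, all pointing away from $f$. Likewise, exactly one of the following holds: (i') $f$ is reverse dominated; (ii') there is a strictly ascending sequence $((A_i,B_i))_{i\in\mathbb{N}}$ of finite order separations of $D$ with pairwise disjoint separators, all pointing towards $f$. Moreover, if $((A_i,B_i))_{i\in\mathbb{N}}$ is a sequence as in (ii) or (ii'), then for any vertex set $U$ consisting of one vertex of $f(A_i\cap B_i)$ for every $i\in\mathbb{N}$, $f$ is the unique vertex-direction of $D$ in the closure of $U$.
   Context: Digraphs have no loops and no parallel edges. $\mathcal{X}(D)$ is the set of finite subsets of $V(D)$. A vertex-direction is a map $f$ on $\mathcal{X}(D)$ sending each $X$ to a strong component of $D-X$ with $f(X)\supseteq f(Y)$ whenever $X\subseteq Y$; it is in the closure of a vertex set $U$ if $f(X)$ meets $U$ for every $X\in\mathcal{X}(D)$. A separation of $D$ is a pair $(A,B)$ with $A\cup B=V(D)$ and no edge from $B\setminus A$ to $A\setminus B$; its separator is $A\cap B$; finite order means $A\cap B$ finite. Separations are ordered by $(A_1,B_1)\le(A_2,B_2)$ iff $A_1\subseteq A_2$ and $B_2\subseteq B_1$; a sequence is strictly descending (ascending) if each term is strictly smaller (larger) than the previous. A finite order separation $(A,B)$ points towards $f$ if $f(A\cap B)\subseteq B\setminus A$ and away from $f$ if $f(A\cap B)\subseteq A\setminus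 B$. A vertex $v$ dominates $f$ if $v\in A$ for every finite order separation $(A,B)$ pointing away from $f$; it reverse dominates $f$ if $v\in B$ for every finite order separation $(A,B)$ pointing towards $f$. $f$ is (reverse) dominated if some vertex (reverse) dominates it. -}

module Defs where

open import Level using (0ℓ) renaming (suc to lsuc)
open import Data.Nat using (ℕ; suc)
open import Data.List using (List; [])
open import Data.List.Membership.Propositional using (_∈_; _∉_)
open import Data.Product using (Σ; ∃; _×_; _,_)
open import Data.Sum using (_⊎_)
open import Data.Empty using (⊥)
open import Relation.Nullary using (¬_)
open import Relation.Binary.PropositionalEquality using (_≡_; _≢_)
open import Function.Bundles using (_⇔_)

record Digraph : Set₁ where
  field
    V     : Set
    E     : V → V → Set
    loopless : ∀ v → ¬ E v v

-- Vertex sets are predicates on V; finite vertex sets (elements of 𝒳(D)) are lists.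
VSet : Set → Set₁
VSet V = V → Set

_⊆ₗ_ : {V : Set} → List V → List V → Set
X ⊆ₗ Y = ∀ v → v ∈ X → v ∈ Y

module _ (D : Digraph) where
  open Digraph D

  data Walk (X : List V) : V → V → Set where
    here : ∀ {u} → u ∉ X → Walk X u u
    step : ∀ {u w v} → u ∉ X → E u w → Walk X w v → Walk X u v

  StronglyConnected : Set
  StronglyConnected = ∀ u v → Walk [] u v

  IsStrongComponent : List V → VSet V → Set
  IsStrongComponent X C =
    Σ V λ v → (v ∉ X) × (∀ w → C w ⇔ (Walk X v w × Walk X w v))

  record VertexDirection : Set₁ where
    field
      dir  : List V → VSet V
      comp : ∀ X → IsStrongComponent X (dir X)
      mono : ∀ X Y → X ⊆ₗ Y → ∀ v → dir Y v → dir X v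
  open VertexDirection public

  _≈ᵈ_ : VertexDirection → VertexDirection → Set
  f ≈ᵈ g = ∀ X v → dir f X v ⇔ dir g X v

  InClosure : VertexDirection → VSet V → Set
  InClosure f U = ∀ X → ∃ λ v → dir f X v × U v

  record FOSep : Set₁ where
    field
      A B   : VSet V
      cover : ∀ v → A v ⊎ B v
      noBack : ∀ u v → B u → ¬ A u → A v → ¬ B v → ¬ E u v
      sep   : List V
      sepSpec : ∀ v → (A v × B v) ⇔ (v ∈ sep)
  open FOSep public

  _≤ˢ_ : FOSep → FOSep → Set
  s ≤ˢ t = (∀ v → A s v → A t v) × (∀ v → B t v → B s v)

  SameSep : FOSep → FOSep → Set
  SameSep s t = (∀ v → A s v ⇔ A t v) × (∀ v → B s v ⇔ B t v)

  _<ˢ_ : FOSep → FOSep → Set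
  s <ˢ t = s ≤ˢ t × ¬ SameSep s t

  PointsTowards : VertexDirection → FOSep → Set
  PointsTowards f s = ∀ v → dir f (sep s) v → B s v × ¬ A s v

  PointsAway : VertexDirection → FOSep → Set
  PointsAway f s = ∀ v → dir f (sep s) v → A s v × ¬ B s v

  Dominates : V → VertexDirection → Set₁
  Dominates v f = ∀ s → PointsAway f s → A s v

  ReverseDominates : V → VertexDirection → Set₁
  ReverseDominates v f = ∀ s → PointsTowards f s → B s v

  Dominated : VertexDirection → Set₁
  Dominated f = Σ V λ v → Dominates v f

  ReverseDominated : VertexDirection → Set₁
  ReverseDominated f = Σ V λ v → ReverseDominates v f

  StrictlyDescending : (ℕ → FOSep) → Set
  StrictlyDescending s = ∀ i → s (suc i) <ˢ s i

  StrictlyAscending : (ℕ → FOSep) → Set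
  StrictlyAscending s = ∀ i → s i <ˢ s (suc i)

  DisjointSeparators : (ℕ → FOSep) → Set
  DisjointSeparators s = ∀ i j → i ≢ j → ∀ v → v ∈ sep (s i) → v ∈ sep (s j) → ⊥

  AwaySequence : VertexDirection → (ℕ → FOSep) → Set
  AwaySequence f s = StrictlyDescending s × DisjointSeparators s × (∀ i → PointsAway f (s i))

  TowardsSequence : VertexDirection → (ℕ → FOSep) → Set
  TowardsSequence f s = StrictlyAscending s × DisjointSeparators s × (∀ i → PointsTowards f (s i))

ExactlyOne : ∀ {a b} → Set a → Set b → Set _
ExactlyOne P Q = (P ⊎ Q) × ¬ (P × Q)

{-# OPTIONS --safe #-}
module Submission where

-- It suffices to treat separations pointing towards f: reversing all edges swaps the sides A and B of every
-- separation and turns the away-statements into the towards-statements.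
--
-- The join (A ∪ A′, B ∩ B′) of two separations pointing towards f points towards f again. If f is not reverse
-- dominated, every vertex lies outside B of some separation pointing towards f, and joining such separations for
-- a vertex of f (A ∩ B) and for all of A ∩ B produces the next term of a strictly ascending sequence whose
-- separators are disjoint. Conversely, for such a sequence no vertex v lies in every B side: a walk from v into
-- A of a late term eventually avoids its separator, yet a walk avoiding the separator cannot leave B ∖ A.
-- Hence each finite X misses the B side of all late terms, so f(X) contains f(A ∩ B) of those terms, and any
-- choice of vertices u i ∈ f(A_i ∩ B_i) converges to f; a direction g in the closure of {u i} must pick late u i
-- once finitely many of them are deleted, which forces g = f.

open import Defs
open import Level using (0ℓ) renaming (suc to lsuc)
open import Data.Nat using (ℕ; zero; suc; _≤_; _≤′_; _⊔_; z≤n; s≤s; _≤?_; ≤′-refl; ≤′-step)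
open import Data.Nat.Properties using (≤-refl; ≤-trans; m≤m⊔n; m≤n⊔m; ≤⇒≤′; <⇒≤; >⇒≢; ≰⇒>; n≤1+n; <-cmp)
open import Data.Product using (Σ; ∃; _×_; _,_; proj₁; proj₂; swap)
open import Data.Sum using (_⊎_; inj₁; inj₂) renaming (swap to ⊎-swap)
open import Data.Empty using (⊥; ⊥-elim)
open import Data.Unit using (⊤; tt)
open import Data.List using (List; []; _∷_; _++_; filter; applyUpTo)
open import Data.List.Membership.Propositional using (_∈_; _∉_)
open import Data.List.Membership.Propositional.Properties using (∈-filter⁺; ∈-filter⁻; ∈-++⁺ˡ; ∈-++⁺ʳ; ∈-applyUpTo⁺)
open import Data.List.Relation.Unary.Any using (here; there)
open import Relation.Nullary using (¬_; yes; no)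
open import Relation.Binary.Definitions using (tri<; tri≈; tri>)
open import Relation.Binary.PropositionalEquality using (_≡_; refl)
open import Function using (_∘_)
open import Function.Bundles using (_⇔_; mk⇔; Equivalence)
open import Function.Construct.Symmetry using (⇔-sym)
open import Axiom.ExcludedMiddle using (ExcludedMiddle)
open import Axiom.DoubleNegationElimination using (em⇒dne)

open Equivalence using (to; from)

Eventually : (ℕ → Set) → Set
Eventually P = ∃ λ N → ∀ i → N ≤ i → P i

eventually-∀∈ : {A : Set} {P : ℕ → A → Set} (xs : List A) →
                (∀ x → Eventually (λ i → P i x)) → Eventually (λ i → ∀ {x} → x ∈ xs → P i x)
eventually-∀∈ [] ev = 0 , λ _ _ ()
eventually-∀∈ (x ∷ xs) ev with ev x | eventually-∀∈ xs ev
... | N , hx | M , hxs = N ⊔ M , λ where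
  i N⊔M≤i (here refl) → hx i (≤-trans (m≤m⊔n N M) N⊔M≤i)
  i N⊔M≤i (there x∈) → hxs i (≤-trans (m≤n⊔m N M) N⊔M≤i) x∈

chain-antitone : {P : ℕ → Set} → (∀ {k} → P (suc k) → P k) → ∀ {i j} → i ≤ j → P j → P i
chain-antitone {P} down = go ∘ ≤⇒≤′
  where
    go : ∀ {i j} → i ≤′ j → P j → P i
    go ≤′-refl p = p
    go (≤′-step i≤′j) p = go i≤′j (down p)

chain-monotone : {P : ℕ → Set} → (∀ {k} → P k → P (suc k)) → ∀ {i j} → i ≤ j → P i → P j
chain-monotone {P} up = go ∘ ≤⇒≤′
  where
    go : ∀ {i j} → i ≤′ j → P i → P j
    go ≤′-refl p = p
    go (≤′-step i≤′j) p = up (go i≤′j p)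

ExactlyOne-cong : ∀ {a b c d} {P : Set a} {Q : Set b} {P′ : Set c} {Q′ : Set d} →
                  P ⇔ P′ → Q ⇔ Q′ → ExactlyOne P Q → ExactlyOne P′ Q′
ExactlyOne-cong P⇔P′ Q⇔Q′ (inj₁ p , excl) = inj₁ (to P⇔P′ p) , λ (p′ , q′) → excl (from P⇔P′ p′ , from Q⇔Q′ q′)
ExactlyOne-cong P⇔P′ Q⇔Q′ (inj₂ q , excl) = inj₂ (to Q⇔Q′ q) , λ (p′ , q′) → excl (from P⇔P′ p′ , from Q⇔Q′ q′)

module _ {D : Digraph} where
  open Digraph D

  private variable
    X Y : List V
    u v w : V
    C C′ : VSet V

  _++ʷ_ : Walk D X u v → Walk D X v w → Walk D X u w
  here _ ++ʷ q = q
  step u∉X e p ++ʷ q = step u∉X e (p ++ʷ q)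

  start∉ : Walk D X u v → u ∉ X
  start∉ (here u∉X) = u∉X
  start∉ (step u∉X _ _) = u∉X

  vertices : Walk D X u v → List V
  vertices (here {u} _) = u ∷ []
  vertices (step {u} _ _ p) = u ∷ vertices p

  end∈vertices : (p : Walk D X u v) → v ∈ vertices p
  end∈vertices (here _) = here refl
  end∈vertices (step _ _ p) = there (end∈vertices p)

  reroute : (p : Walk D X u v) → (∀ {z} → z ∈ vertices p → z ∉ Y) → Walk D Y u v
  reroute (here _) avoids = here (avoids (here refl))
  reroute (step _ e p) avoids = step (avoids (here refl)) e (reroute p (avoids ∘ there))

  ForwardClosed : List V → VSet V → Set
  ForwardClosed X P = ∀ {u w} → P u → E u w → w ∉ X → P w

  forwardClosed-walk : {P : VSet V} → ForwardClosed X P →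
                       (p : Walk D X u v) → P u → ∀ {z} → z ∈ vertices p → P z
  forwardClosed-walk closed (here _) Pu (here refl) = Pu
  forwardClosed-walk closed (step _ _ _) Pu (here refl) = Pu
  forwardClosed-walk closed (step _ e p) Pu (there z∈) = forwardClosed-walk closed p (closed Pu e (start∉ p)) z∈

  module _ (isC : IsStrongComponent D X C) where
    private
      r : V
      r = proj₁ isC

      C⇔ : ∀ w → C w ⇔ (Walk D X r w × Walk D X w r)
      C⇔ = proj₂ (proj₂ isC)

    component-walk : C u → C v → Walk D X u v
    component-walk {u} {v} Cu Cv = proj₂ (to (C⇔ u) Cu) ++ʷ proj₁ (to (C⇔ v) Cv)

    component-closed : C u → Walk D X u v → Walk D X v u → C v
    component-closed {u} Cu u→v v→u = from (C⇔ _) (proj₁ (to (C⇔ u) Cu) ++ʷ u→v , v→u ++ʷ proj₂ (to (C⇔ u) Cu))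

    component-inhabited : Σ V C
    component-inhabited = r , from (C⇔ r) (here r∉X , here r∉X)
      where
        r∉X : r ∉ X
        r∉X = proj₁ (proj₂ isC)

    component-avoids : C u → u ∉ X
    component-avoids Cu = start∉ (component-walk Cu (proj₂ component-inhabited))

  components-coincide : IsStrongComponent D X C → IsStrongComponent D X C′ → C u → C′ u → ∀ w → C w ⇔ C′ w
  components-coincide isC isC′ Cu C′u w =
    mk⇔ (λ Cw → component-closed isC′ C′u (component-walk isC Cu Cw) (component-walk isC Cw Cu))
        (λ C′w → component-closed isC Cu (component-walk isC′ C′u C′w) (component-walk isC′ C′w C′u))

  B∖A : FOSep D → VSet V
  B∖A s v = B s v × ¬ A s v

  ∉sep⇒B∖A : (s : FOSep D) → v ∉ sep s → B s v → B∖A s v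
  ∉sep⇒B∖A s v∉sep Bv = Bv , λ Av → v∉sep (to (sepSpec s _) (Av , Bv))

  B∖A-forwardClosed : (s : FOSep D) → ForwardClosed (sep s) (B∖A s)
  B∖A-forwardClosed s {u} {w} (Bu , ¬Au) e w∉sep with cover s w
  ... | inj₂ Bw = ∉sep⇒B∖A s w∉sep Bw
  ... | inj₁ Aw = ⊥-elim (noBack s u w Bu ¬Au Aw (λ Bw → w∉sep (to (sepSpec s w) (Aw , Bw))) e)

  module _ (f : VertexDirection D) where

    dir⊆B∖A⇒pointsTowards : (s : FOSep D) → sep s ⊆ₗ Y → (∀ {r} → dir f Y r → B∖A s r) → PointsTowards D f s
    dir⊆B∖A⇒pointsTowards {Y} s sep⊆Y fY⊆B∖A z fz =
      forwardClosed-walk (B∖A-forwardClosed s) r→z (fY⊆B∖A fYr) (end∈vertices r→z)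
      where
        r : V
        r = proj₁ (component-inhabited (comp f Y))

        fYr : dir f Y r
        fYr = proj₂ (component-inhabited (comp f Y))

        r→z : Walk D (sep s) r z
        r→z = component-walk (comp f (sep s)) (mono f (sep s) Y sep⊆Y r fYr) fz

    -- A component of D − sep s lying in B ∖ A stays strongly connected once X ⊆ V ∖ B is deleted instead.
    pointsTowards⇒dir⊆ : (s : FOSep D) → PointsTowards D f s → (∀ {x} → x ∈ X → ¬ B s x) →
                         ∀ {w} → dir f (sep s) w → dir f X w
    pointsTowards⇒dir⊆ {X} s towards X∩B=∅ {w} fsw = component-closed (comp f X) fXr (into-X fsr fsw) (into-X fsw fsr)
      where
        r : V
        r = proj₁ (component-inhabited (comp f (X ++ sep s)))

        fYr : dir f (X ++ sep s) r
        fYr = proj₂ (component-inhabited (comp f (X ++ sep s)))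

        fXr : dir f X r
        fXr = mono f X (X ++ sep s) (λ _ → ∈-++⁺ˡ) r fYr

        fsr : dir f (sep s) r
        fsr = mono f (sep s) (X ++ sep s) (λ _ → ∈-++⁺ʳ X) r fYr

        into-X : ∀ {a b} → dir f (sep s) a → dir f (sep s) b → Walk D X a b
        into-X fsa fsb = reroute a→b λ z∈ z∈X →
          X∩B=∅ z∈X (proj₁ (forwardClosed-walk (B∖A-forwardClosed s) a→b (towards _ fsa) z∈))
          where
            a→b : Walk D (sep s) _ _
            a→b = component-walk (comp f (sep s)) fsa fsb

  range : (ℕ → V) → VSet V
  range u w = ∃ λ i → w ≡ u i

  UniqueInClosure : VertexDirection D → VSet V → Set₁
  UniqueInClosure f U = InClosure D f U × ((g : VertexDirection D) → InClosure D g U → _≈ᵈ_ D g f)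

  convergent⇒uniqueInClosure : (f : VertexDirection D) (u : ℕ → V) →
                               (∀ X → Eventually (λ j → dir f X (u j))) → UniqueInClosure f (range u)
  convergent⇒uniqueInClosure f u converges = closure , unique
    where
      closure : InClosure D f (range u)
      closure X = let N , fX∋u = converges X in u N , fX∋u N ≤-refl , N , refl

      unique : (g : VertexDirection D) → InClosure D g (range u) → _≈ᵈ_ D g f
      unique g g-closure X v with converges X
      ... | N , fX∋u with g-closure (X ++ applyUpTo u (suc N))
      ... | w , gw , j , refl with j ≤? N
      ... | yes j≤N = ⊥-elim (component-avoids (comp g _) gw (∈-++⁺ʳ X (∈-applyUpTo⁺ u (s≤s j≤N))))
      ... | no j≰N = components-coincide (comp g X) (comp f X)
                       (mono g X _ (λ _ → ∈-++⁺ˡ) (u j) gw) (fX∋u j (<⇒≤ (≰⇒> j≰N))) v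

  trivialSep : FOSep D
  trivialSep = record
    { A = λ _ → ⊥ ; B = λ _ → ⊤ ; cover = λ _ → inj₂ tt ; noBack = λ _ _ _ _ ()
    ; sep = [] ; sepSpec = λ _ → mk⇔ (λ ()) (λ ()) }

  trivialSep-towards : (f : VertexDirection D) → PointsTowards D f trivialSep
  trivialSep-towards f _ _ = tt , λ ()

  module _ {s : ℕ → FOSep D} (ascending : StrictlyAscending D s) where

    ascending-A : ∀ {i j} → i ≤ j → A (s i) v → A (s j) v
    ascending-A = chain-monotone (λ {k} → proj₁ (proj₁ (ascending k)) _)

    ascending-B : ∀ {i j} → i ≤ j → B (s j) v → B (s i) v
    ascending-B = chain-antitone (λ {k} → proj₂ (proj₁ (ascending k)) _)

    ascending-disjoint : (∀ i {x} → x ∈ sep (s i) → ¬ B (s (suc i)) x) → DisjointSeparators D s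
    ascending-disjoint leaves i j i≢j x x∈i x∈j with <-cmp i j
    ... | tri< i<j _ _ = leaves i x∈i (ascending-B i<j (proj₂ (from (sepSpec (s j) x) x∈j)))
    ... | tri≈ _ i≡j _ = i≢j i≡j
    ... | tri> _ _ j<i = leaves j x∈j (ascending-B j<i (proj₂ (from (sepSpec (s i) x) x∈i)))

module _ (em : ExcludedMiddle 0ℓ) {D : Digraph} where
  open Digraph D

  private
    dne : {P : Set} → ¬ ¬ P → P
    dne = em⇒dne em

  noBack-join : (s t : FOSep D) → ∀ {u v} → B s u → B t u → ¬ A s u → ¬ A t u →
                A s v → ¬ (B s v × B t v) → ¬ E u v
  noBack-join s t {u} {v} Bsu Btu ¬Asu ¬Atu Asv ¬Bv with em {B s v}
  ... | no ¬Bsv = noBack s u v Bsu ¬Asu Asv ¬Bsv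
  ... | yes Bsv with cover t v
  ...   | inj₁ Atv = noBack t u v Btu ¬Atu Atv (λ Btv → ¬Bv (Bsv , Btv))
  ...   | inj₂ Btv = ⊥-elim (¬Bv (Bsv , Btv))

  join : FOSep D → FOSep D → FOSep D
  join s t = record
    { A = Aj ; B = Bj ; cover = cover-join ; noBack = noBack-join′
    ; sep = filter (λ _ → em) (sep s ++ sep t) ; sepSpec = sepSpec-join }
    where
      Aj Bj : VSet V
      Aj v = A s v ⊎ A t v
      Bj v = B s v × B t v

      cover-join : ∀ v → Aj v ⊎ Bj v
      cover-join v with cover s v | cover t v
      ... | inj₁ Asv | _ = inj₁ (inj₁ Asv)
      ... | inj₂ _ | inj₁ Atv = inj₁ (inj₂ Atv)
      ... | inj₂ Bsv | inj₂ Btv = inj₂ (Bsv , Btv)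

      noBack-join′ : ∀ u v → Bj u → ¬ Aj u → Aj v → ¬ Bj v → ¬ E u v
      noBack-join′ u v (Bsu , Btu) ¬Au (inj₁ Asv) ¬Bv = noBack-join s t Bsu Btu (¬Au ∘ inj₁) (¬Au ∘ inj₂) Asv ¬Bv
      noBack-join′ u v (Bsu , Btu) ¬Au (inj₂ Atv) ¬Bv = noBack-join t s Btu Bsu (¬Au ∘ inj₂) (¬Au ∘ inj₁) Atv (¬Bv ∘ swap)

      in-seps : ∀ {v} → Aj v × Bj v → v ∈ sep s ++ sep t
      in-seps (inj₁ Asv , Bsv , _) = ∈-++⁺ˡ (to (sepSpec s _) (Asv , Bsv))
      in-seps (inj₂ Atv , _ , Btv) = ∈-++⁺ʳ (sep s) (to (sepSpec t _) (Atv , Btv))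

      sepSpec-join : ∀ v → (Aj v × Bj v) ⇔ (v ∈ filter (λ _ → em) (sep s ++ sep t))
      sepSpec-join v = mk⇔ (λ ABv → ∈-filter⁺ (λ _ → em) (in-seps ABv) ABv)
                           (proj₂ ∘ ∈-filter⁻ (λ _ → em) {xs = sep s ++ sep t})

  join-towards : (f : VertexDirection D) (s t : FOSep D) →
                 PointsTowards D f s → PointsTowards D f t → PointsTowards D f (join s t)
  join-towards f s t s-towards t-towards =
    dir⊆B∖A⇒pointsTowards f (join s t) (λ _ → proj₁ ∘ ∈-filter⁻ (λ _ → em) {xs = sep s ++ sep t}) in-B∖A
    where
      in-B∖A : ∀ {r} → dir f (sep s ++ sep t) r → B∖A (join s t) r
      in-B∖A {r} fr with s-towards r (mono f (sep s) _ (λ _ → ∈-++⁺ˡ) r fr)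
                       | t-towards r (mono f (sep t) _ (λ _ → ∈-++⁺ʳ (sep s)) r fr)
      ... | Bsr , ¬Asr | Btr , ¬Atr = (Bsr , Btr) , λ where
        (inj₁ Asr) → ¬Asr Asr
        (inj₂ Atr) → ¬Atr Atr

  <ˢ⇒A-inhabited : ∀ {s t} → _<ˢ_ D s t → Σ V (A t)
  <ˢ⇒A-inhabited {s} {t} ((As⊆At , Bt⊆Bs) , s≉t) with em {Σ V (A t)}
  ... | yes At≠∅ = At≠∅
  ... | no At=∅ = ⊥-elim (s≉t ((λ v → mk⇔ (As⊆At v) (λ Atv → ⊥-elim (At=∅ (v , Atv)))) ,
                               (λ v → mk⇔ (Bs⊆Bt v) (Bt⊆Bs v))))
    where
      Bs⊆Bt : ∀ v → B s v → B t v
      Bs⊆Bt v _ with cover t v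
      ... | inj₁ Atv = ⊥-elim (At=∅ (v , Atv))
      ... | inj₂ Btv = Btv

  disjoint⇒eventually-avoids : {s : ℕ → FOSep D} → DisjointSeparators D s → ∀ z → Eventually (λ i → z ∉ sep (s i))
  disjoint⇒eventually-avoids {s} disjoint z with em {∃ λ j → z ∈ sep (s j)}
  ... | yes (j , z∈j) = suc j , λ i j<i z∈i → disjoint i j (>⇒≢ j<i) z z∈i z∈j
  ... | no ∄j = 0 , λ i _ z∈i → ∄j (i , z∈i)

  module _ (sc : StronglyConnected D) {s : ℕ → FOSep D}
           (ascending : StrictlyAscending D s) (disjoint : DisjointSeparators D s) where

    no-common-B : ∀ {v} → ¬ (∀ i → B (s i) v)
    no-common-B {v} v∈B =
      let y , A₁y = <ˢ⇒A-inhabited {s 0} {s 1} (ascending 0)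
          p = sc v y
          N , p-avoids = eventually-∀∈ (vertices p) (disjoint⇒eventually-avoids {s} disjoint)
          i = suc N
          q = reroute p (p-avoids i (n≤1+n N))
          y∈B∖A = forwardClosed-walk (B∖A-forwardClosed (s i)) q (∉sep⇒B∖A (s i) (start∉ q) (v∈B i)) (end∈vertices q)
      in proj₂ y∈B∖A (ascending-A {s = s} ascending (s≤s z≤n) A₁y)

    eventually-¬B : ∀ x → Eventually (λ i → ¬ B (s i) x)
    eventually-¬B x with em {∃ λ j → ¬ B (s j) x}
    ... | yes (j , ¬Bjx) = j , λ i j≤i Bix → ¬Bjx (ascending-B {s = s} ascending j≤i Bix)
    ... | no ∄j = ⊥-elim (no-common-B λ i → dne λ ¬Bix → ∄j (i , ¬Bix))

    towards-converges : (f : VertexDirection D) → (∀ i → PointsTowards D f (s i)) →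
                        (u : ℕ → V) → (∀ i → dir f (sep (s i)) (u i)) → ∀ X → Eventually (λ j → dir f X (u j))
    towards-converges f towards u u∈f X =
      let N , X∩B=∅ = eventually-∀∈ X eventually-¬B
      in N , λ j N≤j → pointsTowards⇒dir⊆ f (s j) (towards j) (X∩B=∅ j N≤j) (u∈f j)

  module _ (em₁ : ExcludedMiddle (lsuc 0ℓ)) (f : VertexDirection D) (¬rdom : ¬ ReverseDominated D f) where

    TowardsAvoiding : V → Set₁
    TowardsAvoiding w = Σ (FOSep D) λ t → PointsTowards D f t × ¬ B t w

    towardsAvoiding : ∀ w → TowardsAvoiding w
    towardsAvoiding w with em₁ {TowardsAvoiding w}
    ... | yes t = t
    ... | no ∄t = ⊥-elim (¬rdom (w , λ t towards → dne λ ¬Btw → ∄t (t , towards , ¬Btw)))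

    joinAvoiding : FOSep D → List V → FOSep D
    joinAvoiding s [] = s
    joinAvoiding s (w ∷ ws) = join (joinAvoiding s ws) (proj₁ (towardsAvoiding w))

    joinAvoiding-towards : ∀ s ws → PointsTowards D f s → PointsTowards D f (joinAvoiding s ws)
    joinAvoiding-towards s [] towards = towards
    joinAvoiding-towards s (w ∷ ws) towards = join-towards f (joinAvoiding s ws) (proj₁ (towardsAvoiding w))
      (joinAvoiding-towards s ws towards) (proj₁ (proj₂ (towardsAvoiding w)))

    joinAvoiding-≤ : ∀ s ws → _≤ˢ_ D s (joinAvoiding s ws)
    joinAvoiding-≤ s [] = (λ _ As → As) , (λ _ Bs → Bs)
    joinAvoiding-≤ s (w ∷ ws) = (λ v → inj₁ ∘ proj₁ s≤ v) , (λ v → proj₂ s≤ v ∘ proj₁)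
      where
        s≤ : _≤ˢ_ D s (joinAvoiding s ws)
        s≤ = joinAvoiding-≤ s ws

    joinAvoiding-¬B : ∀ s {ws w} → w ∈ ws → ¬ B (joinAvoiding s ws) w
    joinAvoiding-¬B s {w ∷ _} (here refl) (_ , Bw) = proj₂ (proj₂ (towardsAvoiding w)) Bw
    joinAvoiding-¬B s (there w∈) (Bw , _) = joinAvoiding-¬B s w∈ Bw

    pick : (s : FOSep D) → Σ V (dir f (sep s))
    pick s = component-inhabited (comp f (sep s))

    next : FOSep D → FOSep D
    next s = joinAvoiding s (proj₁ (pick s) ∷ sep s)

    <ˢ-next : ∀ {s} → PointsTowards D f s → _<ˢ_ D s (next s)
    <ˢ-next {s} towards = joinAvoiding-≤ s (w ∷ sep s) , λ (_ , B⇔) →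
      joinAvoiding-¬B s {w ∷ sep s} (here refl) (to (B⇔ w) (proj₁ (towards w fw)))
      where
        w : V
        w = proj₁ (pick s)

        fw : dir f (sep s) w
        fw = proj₂ (pick s)

    towardsChain : ℕ → Σ (FOSep D) (PointsTowards D f)
    towardsChain zero = trivialSep , trivialSep-towards f
    towardsChain (suc i) = let s , towards = towardsChain i in
      next s , joinAvoiding-towards s (proj₁ (pick s) ∷ sep s) towards

    ¬reverseDominated⇒towardsSequence : Σ (ℕ → FOSep D) (TowardsSequence D f)
    ¬reverseDominated⇒towardsSequence = s , ascending , ascending-disjoint {s = s} ascending leaves , proj₂ ∘ towardsChain
      where
        s : ℕ → FOSep D
        s = proj₁ ∘ towardsChain

        ascending : StrictlyAscending D s
        ascending i = <ˢ-next (proj₂ (towardsChain i))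

        leaves : ∀ i {x} → x ∈ sep (s i) → ¬ B (s (suc i)) x
        leaves i x∈ = joinAvoiding-¬B (s i) {proj₁ (pick (s i)) ∷ sep (s i)} (there x∈)

  towards-dichotomy : ExcludedMiddle (lsuc 0ℓ) → StronglyConnected D → (f : VertexDirection D) →
                      ExactlyOne (ReverseDominated D f) (Σ (ℕ → FOSep D) (TowardsSequence D f))
  towards-dichotomy em₁ sc f = dichotomy , λ ((v , rdom) , s , ascending , disjoint , towards) →
    no-common-B sc {s} ascending disjoint λ i → rdom (s i) (towards i)
    where
      dichotomy : ReverseDominated D f ⊎ Σ (ℕ → FOSep D) (TowardsSequence D f)
      dichotomy with em₁ {ReverseDominated D f}
      ... | yes rdom = inj₁ rdom
      ... | no ¬rdom = inj₂ (¬reverseDominated⇒towardsSequence em₁ f ¬rdom)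

  towards-uniqueInClosure : StronglyConnected D → (f : VertexDirection D) (s : ℕ → FOSep D) → TowardsSequence D f s →
                            (u : ℕ → V) → (∀ i → dir f (sep (s i)) (u i)) → UniqueInClosure f (range {D} u)
  towards-uniqueInClosure sc f s (ascending , disjoint , towards) u u∈f =
    convergent⇒uniqueInClosure f u (towards-converges sc {s} ascending disjoint f towards u u∈f)

reverse : Digraph → Digraph
reverse D = record { V = V ; E = λ u v → E v u ; loopless = loopless }
  where open Digraph D

module _ {D : Digraph} where
  open Digraph D

  private variable
    X : List V
    u v w : V

  reverse-walk-acc : Walk D X u v → Walk (reverse D) X u w → Walk (reverse D) X v w
  reverse-walk-acc (here _) acc = acc
  reverse-walk-acc (step _ e p) acc = reverse-walk-acc p (step (start∉ p) e acc)

  reverse-walk : Walk D X u v → Walk (reverse D) X v u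
  reverse-walk p = reverse-walk-acc p (here (start∉ p))

  reverse-stronglyConnected : StronglyConnected D → StronglyConnected (reverse D)
  reverse-stronglyConnected sc u v = reverse-walk (sc v u)

module _ {D : Digraph} where
  open Digraph D

  private variable
    X : List V
    C : VSet V

  reverse-component : IsStrongComponent D X C → IsStrongComponent (reverse D) X C
  reverse-component (r , r∉X , C⇔) = r , r∉X , λ w → mk⇔
    (λ Cw → let r→w , w→r = to (C⇔ w) Cw in reverse-walk w→r , reverse-walk r→w)
    (λ (r→w , w→r) → from (C⇔ w) (reverse-walk w→r , reverse-walk r→w))

  reverse-dir : VertexDirection D → VertexDirection (reverse D)
  reverse-dir f = record { dir = dir f ; comp = reverse-component ∘ comp f ; mono = mono f }

  reverse-sep : FOSep D → FOSep (reverse D)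
  reverse-sep s = record
    { A = B s ; B = A s ; cover = ⊎-swap ∘ cover s
    ; noBack = λ u v Asu ¬Bsu Bsv ¬Asv → noBack s v u Bsv ¬Asv Asu ¬Bsu
    ; sep = sep s ; sepSpec = λ v → mk⇔ (to (sepSpec s v) ∘ swap) (swap ∘ from (sepSpec s v)) }

  reverse-sep-< : ∀ {s t} → _<ˢ_ D s t → _<ˢ_ (reverse D) (reverse-sep t) (reverse-sep s)
  reverse-sep-< ((As⊆At , Bt⊆Bs) , s≉t) = (Bt⊆Bs , As⊆At) , λ (B⇔ , A⇔) → s≉t (⇔-sym ∘ A⇔ , ⇔-sym ∘ B⇔)

module _ {D : Digraph} where
  open Digraph D

  dominated⇔reverseDominated : (f : VertexDirection D) → Dominated D f ⇔ ReverseDominated (reverse D) (reverse-dir f)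
  dominated⇔reverseDominated f = mk⇔ (λ (v , dom) → v , λ s towards → dom (reverse-sep {reverse D} s) towards)
                                     (λ (v , rdom) → v , λ s away → rdom (reverse-sep s) away)

  away⇒reverse-towards : (f : VertexDirection D) (s : ℕ → FOSep D) → AwaySequence D f s → TowardsSequence (reverse D) (reverse-dir f) (reverse-sep ∘ s)
  away⇒reverse-towards f s (descending , disjoint , away) =
    (λ i → reverse-sep-< {s = s (suc i)} {s i} (descending i)) , disjoint , away

  awaySequence⇔reverse-towardsSequence : (f : VertexDirection D) →
    Σ (ℕ → FOSep D) (AwaySequence D f) ⇔ Σ (ℕ → FOSep (reverse D)) (TowardsSequence (reverse D) (reverse-dir f))
  awaySequence⇔reverse-towardsSequence f = mk⇔
    (λ (s , away-seq) → reverse-sep {D} ∘ s , away⇒reverse-towards f s away-seq)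
    (λ (s , ascending , disjoint , towards) →
       reverse-sep {reverse D} ∘ s , (λ i → reverse-sep-< {reverse D} {s i} {s (suc i)} (ascending i)) , disjoint , towards)

  reverse-uniqueInClosure : (f : VertexDirection D) (u : ℕ → V) →
                            UniqueInClosure (reverse-dir f) (range {reverse D} u) → UniqueInClosure f (range {D} u)
  reverse-uniqueInClosure f u (closure , unique) = closure , λ g g-closure → unique (reverse-dir g) g-closure

lemma4p5 : ExcludedMiddle 0ℓ → ExcludedMiddle (lsuc 0ℓ) →
    (D : Digraph) → StronglyConnected D → (f : VertexDirection D) →
    ExactlyOne (Dominated D f) (Σ (ℕ → FOSep D) λ s → AwaySequence D f s)
    × ExactlyOne (ReverseDominated D f) (Σ (ℕ → FOSep D) λ s → TowardsSequence D f s)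
    × ((s : ℕ → FOSep D) → AwaySequence D f s ⊎ TowardsSequence D f s →
       (u : ℕ → Digraph.V D) → (∀ i → dir f (sep (s i)) (u i)) →
       InClosure D f (λ w → ∃ λ i → w ≡ u i)
       × ((g : VertexDirection D) → InClosure D g (λ w → ∃ λ i → w ≡ u i) → _≈ᵈ_ D g f))
lemma4p5 em₀ em₁ D sc f =
    ExactlyOne-cong (⇔-sym (dominated⇔reverseDominated f)) (⇔-sym (awaySequence⇔reverse-towardsSequence f))
                    (towards-dichotomy em₀ em₁ sc′ (reverse-dir f))
  , towards-dichotomy em₀ em₁ sc f
  , uniqueInClosure
  where
    sc′ : StronglyConnected (reverse D)
    sc′ = reverse-stronglyConnected sc

    uniqueInClosure : (s : ℕ → FOSep D) → AwaySequence D f s ⊎ TowardsSequence D f s →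
                      (u : ℕ → Digraph.V D) → (∀ i → dir f (sep (s i)) (u i)) → UniqueInClosure f (range {D} u)
    uniqueInClosure s (inj₁ away) u u∈f =
      reverse-uniqueInClosure f u
        (towards-uniqueInClosure em₀ sc′ (reverse-dir f) (reverse-sep {D} ∘ s) (away⇒reverse-towards f s away) u u∈f)
    uniqueInClosure s (inj₂ towards) u u∈f = towards-uniqueInClosure em₀ sc f s towards u u∈f
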